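{- Let $D$ be a diagram with $|G(D)|=0$ and let $D_1,D_2\in\mathcal{P}_G(D)$. Then $D_1$ covers $D_2$ in $\mathcal{P}_G(D)$ if and only if there exists $r\in\mathbb{Z}_{>0}$ such that $D_2=\mathcal{G}(D_1,r)\neq D_1$.
   Context: A diagram is a finite set of cells placed at positions $(r,c)\in\mathbb{Z}_{>0}\times\mathbb{Z}_{>0}$ ($r$ the row, counted from the bottom; $c$ the column), each position holding at most one cell; each cell is either an ordinary cell, written $(r,c)$, or a ghost cell, written $\langle r,c\rangle$. A position is empty if it holds no cell of either kind. $G(D)$ denotes the set of ghost cells of $D$. The ghost move at row $r$ of $D$, with result denoted $\mathcal{G}(D,r)$, is defined as follows: if row $r$ is empty, $\mathcal{G}(D,r)=D$. Otherwise let $c$ be the largest column of a cell in row $r$. If this rightmost cell is a ghost cell, or there is no empty position $(\hat r,c)$ with $\hat r<r$, or, letting $\hat r<r$ be maximal with $(\hat r,c)$ empty, there is a ghost cell $\langle r^*,c\rangle$ with $\hat r<r^*<r$, then $\mathcal{G}(D,r)=D$. Otherwise, with $\hat r<r$ maximal such that $(\hat r,c)$ is empty, $\mathcal{G}(D,r)=(D\setminus\{(r,c)\})\cup\{(\hat r,c),\langle r,c\rangle\}$. $\mathrm{GKD}(D)$ is the set of all diagrams obtainable from $D$ by finite (possibly empty) sequences of ghost moves. The ghost Kohnert poset $\mathcal{P}_G(D)$ has underlying set $\mathrm{GKD}(D)$, with $D_2\preceq D_1$ iff $D_2$ can be obtained from $D_1$ by a finite (possibly empty) sequence of ghost moves;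 $D_1$ covers $D_2$ means $D_2\prec D_1$ and no $T$ satisfies $D_2\prec T\prec D_1$. -}

module Defs where

open import Data.Nat using (ℕ; zero; suc; _≤_; _≡ᵇ_)
open import Data.Bool using (Bool; true; false; if_then_else_; _∧_)
open import Data.Maybe using (Maybe; just; nothing)
open import Data.Product using (Σ; _×_; ∃; _,_)
open import Data.Sum using (_⊎_)
open import Relation.Binary.PropositionalEquality using (_≡_)
open import Relation.Nullary using (¬_)

data Cell : Set where
  empty ordinary ghost : Cell

-- A (raw) diagram: the content of every position (r , c).
-- Convention: indices are 0-based, i.e. Agda row/column k is the
-- paper's row/column k+1 (rows counted from the bottom).
Diagram : Set
Diagram = ℕ → ℕ → Cell

_≈_ : Diagram → Diagram → Set
D ≈ E = ∀ r c → D r c ≡ E r c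

Bounded : ℕ → Diagram → Set
Bounded N D = ∀ r c → (N ≤ r ⊎ N ≤ c) → D r c ≡ empty

Finite : Diagram → Set
Finite D = ∃ λ N → Bounded N D

NoGhost : Diagram → Set
NoGhost D = ∀ r c → ¬ (D r c ≡ ghost)

rightmost : (ℕ → Cell) → ℕ → Maybe ℕ
rightmost row zero = nothing
rightmost row (suc n) with row n
... | empty = rightmost row n
... | ordinary = just n
... | ghost = just n

-- Given the column g (row index ↦ content) and a row r, scan the rows
-- r-1, r-2, ..., 0: returns  just r̂  where r̂ < r is maximal with (r̂,c)
-- empty, provided no ghost cell lies strictly between r̂ and r;
-- otherwise (no empty position below, or a ghost in between) nothing.
dropRow : (ℕ → Cell) → ℕ → Maybe ℕ
dropRow g zero = nothing
dropRow g (suc k) with g k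
... | empty = just k
... | ghost = nothing
... | ordinary = dropRow g k

relocate : Diagram → ℕ → ℕ → ℕ → Diagram
relocate D r c r̂ r' c' =
  if (r' ≡ᵇ r̂) ∧ (c' ≡ᵇ c) then ordinary
  else if (r' ≡ᵇ r) ∧ (c' ≡ᵇ c) then ghost
  else D r' c'

moveAt : Diagram → ℕ → ℕ → Diagram
moveAt D r c with D r c
... | empty = D
... | ghost = D
... | ordinary with dropRow (λ x → D x c) r
...   | nothing = D
...   | just r̂ = relocate D r c r̂

-- The ghost move 𝒢(D, r), for a diagram D whose cells lie in columns < N
-- (N only bounds the search for the rightmost cell of row r; for every
-- diagram Bounded by N the result is the paper's 𝒢(D,r)).
ghostMove : ℕ → Diagram → ℕ → Diagram
ghostMove N D r with rightmost (D r) N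
... | nothing = D
... | just c = moveAt D r c

data Reach (N : ℕ) : Diagram → Diagram → Set where
  done : ∀ {D₁ D₂} → D₂ ≈ D₁ → Reach N D₁ D₂
  step : ∀ {D₁ D₂} (r : ℕ) → Reach N (ghostMove N D₁ r) D₂ → Reach N D₁ D₂

_⪯[_]_ : Diagram → ℕ → Diagram → Set
D₂ ⪯[ N ] D₁ = Reach N D₁ D₂

_≺[_]_ : Diagram → ℕ → Diagram → Set
D₂ ≺[ N ] D₁ = (D₂ ⪯[ N ] D₁) × ¬ (D₂ ≈ D₁)

Covers : ℕ → Diagram → Diagram → Set
Covers N D₁ D₂ = (D₂ ≺[ N ] D₁) × (∀ T → ¬ ((D₂ ≺[ N ] T) × (T ≺[ N ] D₁)))

InGKD : ℕ → Diagram → Diagram → Set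
InGKD N D D' = Reach N D D'

{-# OPTIONS --safe #-}
module Submission where

-- Ghost cells are never removed, and a move that changes D₁ adds exactly one
-- ghost, ⟨r,c⟩ at the old position of the moved cell.  Hence every proper
-- descent D₂ ≺ D₁ has a ghost absent from D₁, which makes the cover relation
-- rigid: if D₂ = 𝒢(D₁,r) ≠ D₁ and D₂ ≺ T ≺ D₁, then both T's new ghost over D₁
-- and D₂'s new ghost over T must be ⟨r,c⟩, which is absurd.  Conversely the
-- first proper move 𝒢(D₁,r) of a descent to D₂ satisfies D₂ ⪯ 𝒢(D₁,r) ≺ D₁, so
-- it equals D₂ when D₁ covers D₂.  Neither argument needs the hypotheses on D.

open import Defs
open import Data.Nat using (ℕ; zero; suc; _≡ᵇ_)
open import Data.Nat.Properties using (≡ᵇ⇒≡; ≡⇒≡ᵇ)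
open import Data.Bool using (true; false; _∧_)
open import Data.Bool.Properties using (T-≡; T-∧)
open import Data.Maybe using (just; nothing)
open import Data.Product using (∃; ∃₂; _×_; _,_)
open import Data.Sum using (_⊎_; inj₁; inj₂)
open import Data.Empty using (⊥-elim)
open import Function.Bundles using (_⇔_; mk⇔; Equivalence)
open import Relation.Nullary using (¬_)
open import Relation.Binary.PropositionalEquality

open Equivalence using (to; from)

≈-refl : ∀ {D} → D ≈ D
≈-refl _ _ = refl

≈-sym : ∀ {D E} → D ≈ E → E ≈ D
≈-sym p r c = sym (p r c)

≈-trans : ∀ {D E F} → D ≈ E → E ≈ F → D ≈ F
≈-trans p q r c = trans (p r c) (q r c)

ordinary≢ghost : ordinary ≢ ghost
ordinary≢ghost ()

empty≢ghost : empty ≢ ghost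
empty≢ghost ()

ordinary≢empty : ordinary ≢ empty
ordinary≢empty ()

∧-≡ᵇ⇒≡ : ∀ a b c d → (a ≡ᵇ b) ∧ (c ≡ᵇ d) ≡ true → a ≡ b × c ≡ d
∧-≡ᵇ⇒≡ a b c d eq with T-∧ .to (T-≡ .from eq)
... | a≡ᵇb , c≡ᵇd = ≡ᵇ⇒≡ a b a≡ᵇb , ≡ᵇ⇒≡ c d c≡ᵇd

∧-≡ᵇ-refl : ∀ a c → (a ≡ᵇ a) ∧ (c ≡ᵇ c) ≡ true
∧-≡ᵇ-refl a c = T-≡ .to (T-∧ .from (≡⇒≡ᵇ a a refl , ≡⇒≡ᵇ c c refl))

rightmost-cong : ∀ {f g : ℕ → Cell} → (∀ c → f c ≡ g c) → ∀ n → rightmost f n ≡ rightmost g n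
rightmost-cong e zero = refl
rightmost-cong {f} {g} e (suc n) with f n | g n | e n
... | empty    | .empty    | refl = rightmost-cong e n
... | ordinary | .ordinary | refl = refl
... | ghost    | .ghost    | refl = refl

dropRow-cong : ∀ {f g : ℕ → Cell} → (∀ r → f r ≡ g r) → ∀ n → dropRow f n ≡ dropRow g n
dropRow-cong e zero = refl
dropRow-cong {f} {g} e (suc n) with f n | g n | e n
... | empty    | .empty    | refl = refl
... | ordinary | .ordinary | refl = dropRow-cong e n
... | ghost    | .ghost    | refl = refl

relocate-cong : ∀ {E F} → E ≈ F → ∀ r c r̂ → relocate E r c r̂ ≈ relocate F r c r̂
relocate-cong E≈F r c r̂ x y rewrite E≈F x y = refl

moveAt-cong : ∀ {E F} → E ≈ F → ∀ r c → moveAt E r c ≈ moveAt F r c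
moveAt-cong {E} {F} E≈F r c with E r c | F r c | E≈F r c
... | empty    | .empty    | refl = E≈F
... | ghost    | .ghost    | refl = E≈F
... | ordinary | .ordinary | refl
  with dropRow (λ x → E x c) r | dropRow (λ x → F x c) r | dropRow-cong (λ x → E≈F x c) r
...   | nothing | .nothing  | refl = E≈F
...   | just r̂  | .(just r̂) | refl = relocate-cong E≈F r c r̂

ghostMove-cong : ∀ N {E F} → E ≈ F → ∀ r → ghostMove N E r ≈ ghostMove N F r
ghostMove-cong N {E} {F} E≈F r with rightmost (E r) N | rightmost (F r) N | rightmost-cong (E≈F r) N
... | nothing | .nothing  | refl = E≈F
... | just c  | .(just c) | refl = moveAt-cong E≈F r c

dropRow-just⇒empty : ∀ g n {r̂} → dropRow g n ≡ just r̂ → g r̂ ≡ empty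
dropRow-just⇒empty g (suc n) eq with g n in gn
dropRow-just⇒empty g (suc n) refl | empty    = gn
dropRow-just⇒empty g (suc n) eq   | ordinary = dropRow-just⇒empty g n eq

relocate-source : ∀ E {r c r̂} → E r c ≡ ordinary → E r̂ c ≡ empty → relocate E r c r̂ r c ≡ ghost
relocate-source E {r} {c} {r̂} ord emp with (r ≡ᵇ r̂) ∧ (c ≡ᵇ c) in eq
... | true with ∧-≡ᵇ⇒≡ r r̂ c c eq
...   | refl , _ = ⊥-elim (ordinary≢empty (trans (sym ord) emp))
relocate-source E {r} {c} {r̂} ord emp | false rewrite ∧-≡ᵇ-refl r c = refl

relocate-preserves-ghost : ∀ E {r c r̂ x y} → E r̂ c ≡ empty → E x y ≡ ghost →
  relocate E r c r̂ x y ≡ ghost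
relocate-preserves-ghost E {r} {c} {r̂} {x} {y} emp g with (x ≡ᵇ r̂) ∧ (y ≡ᵇ c) in eq
... | true with ∧-≡ᵇ⇒≡ x r̂ y c eq
...   | refl , refl = ⊥-elim (empty≢ghost (trans (sym emp) g))
relocate-preserves-ghost E {r} {c} {r̂} {x} {y} emp g | false with (x ≡ᵇ r) ∧ (y ≡ᵇ c)
...   | true  = refl
...   | false = g

relocate-new-ghost : ∀ E {r c r̂ x y} → relocate E r c r̂ x y ≡ ghost → E x y ≢ ghost →
  x ≡ r × y ≡ c
relocate-new-ghost E {r} {c} {r̂} {x} {y} g ¬g with (x ≡ᵇ r̂) ∧ (y ≡ᵇ c)
... | true = ⊥-elim (ordinary≢ghost g)
... | false with (x ≡ᵇ r) ∧ (y ≡ᵇ c) in eq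
...   | true  = ∧-≡ᵇ⇒≡ x r y c eq
...   | false = ⊥-elim (¬g g)

_⊆ᴳ_ : Diagram → Diagram → Set
E ⊆ᴳ F = ∀ {x y} → E x y ≡ ghost → F x y ≡ ghost

NewGhost : Diagram → Diagram → Set
NewGhost E F = ∃₂ λ x y → F x y ≡ ghost × E x y ≢ ghost

newGhost⇒≉ : ∀ {E F} → NewGhost E F → ¬ F ≈ E
newGhost⇒≉ (x , y , g , ¬g) F≈E = ¬g (trans (sym (F≈E x y)) g)

newGhost-⊆ᴳ : ∀ {E F F'} → NewGhost E F → F ⊆ᴳ F' → NewGhost E F'
newGhost-⊆ᴳ (x , y , g , ¬g) F⊆F' = x , y , F⊆F' g , ¬g

record Relocation (E : Diagram) (r : ℕ) (F : Diagram) : Set where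
  field
    column target   : ℕ
    source-ordinary : E r column ≡ ordinary
    target-empty    : E target column ≡ empty
    result          : F ≈ relocate E r column target

  ghost-at-source : F r column ≡ ghost
  ghost-at-source = trans (result r column) (relocate-source E source-ordinary target-empty)

  ghosts-preserved : E ⊆ᴳ F
  ghosts-preserved {x} {y} g = trans (result x y) (relocate-preserves-ghost E target-empty g)

  new-ghost-at-source : ∀ {x y} → F x y ≡ ghost → E x y ≢ ghost → x ≡ r × y ≡ column
  new-ghost-at-source {x} {y} g = relocate-new-ghost E (trans (sym (result x y)) g)

  new-ghost : NewGhost E F
  new-ghost = r , column , ghost-at-source , λ g → ordinary≢ghost (trans (sym source-ordinary) g)

relocation-resp-≈ : ∀ {E r F F'} → F' ≈ F → Relocation E r F → Relocation E r F'
relocation-resp-≈ F'≈F R = record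
  { column = column ; target = target ; source-ordinary = source-ordinary
  ; target-empty = target-empty ; result = ≈-trans F'≈F result }
  where open Relocation R

ghostMove-view : ∀ N E r → ghostMove N E r ≈ E ⊎ Relocation E r (ghostMove N E r)
ghostMove-view N E r with rightmost (E r) N
... | nothing = inj₁ ≈-refl
... | just c with E r c in Erc
...   | empty = inj₁ ≈-refl
...   | ghost = inj₁ ≈-refl
...   | ordinary with dropRow (λ x → E x c) r in drop
...     | nothing = inj₁ ≈-refl
...     | just r̂  = inj₂ (record
            { column = c ; target = r̂ ; source-ordinary = Erc
            ; target-empty = dropRow-just⇒empty (λ x → E x c) r drop ; result = ≈-refl })

ghostMove-⊆ᴳ : ∀ N E r → E ⊆ᴳ ghostMove N E r
ghostMove-⊆ᴳ N E r {x} {y} g with ghostMove-view N E r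
... | inj₁ trivial = trans (trivial x y) g
... | inj₂ R       = Relocation.ghosts-preserved R g

reach-⊆ᴳ : ∀ {N E F} → Reach N E F → E ⊆ᴳ F
reach-⊆ᴳ (done F≈E) {x} {y} g = trans (F≈E x y) g
reach-⊆ᴳ {N} {E} (step r rest) g = reach-⊆ᴳ rest (ghostMove-⊆ᴳ N E r g)

reach-≈-or-newGhost : ∀ {N E F} → Reach N E F → F ≈ E ⊎ NewGhost E F
reach-≈-or-newGhost (done F≈E) = inj₁ F≈E
reach-≈-or-newGhost {N} {E} (step r rest) with ghostMove-view N E r | reach-≈-or-newGhost rest
... | inj₁ trivial | inj₁ F≈E' = inj₁ (≈-trans F≈E' trivial)
... | inj₁ trivial | inj₂ (x , y , g , ¬g) = inj₂ (x , y , g , λ h → ¬g (trans (trivial x y) h))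
... | inj₂ R       | _ = inj₂ (newGhost-⊆ᴳ (Relocation.new-ghost R) (reach-⊆ᴳ rest))

reach-resp-≈ : ∀ {N E E' F} → Reach N E F → E ≈ E' → Reach N E' F
reach-resp-≈ (done F≈E)        E≈E' = done (≈-trans F≈E E≈E')
reach-resp-≈ {N} (step r rest) E≈E' = step r (reach-resp-≈ rest (ghostMove-cong N E≈E' r))

-- The start E is only ≈ D, so that skipping a trivial move stays structural recursion.
reach-first-proper-move : ∀ {N E D F} → Reach N E F → E ≈ D → ¬ F ≈ D →
  ∃ λ r → ¬ ghostMove N D r ≈ D × Reach N (ghostMove N D r) F
reach-first-proper-move (done F≈E) E≈D F≉D = ⊥-elim (F≉D (≈-trans F≈E E≈D))
reach-first-proper-move {N} {E} {D} (step r rest) E≈D F≉D with ghostMove-view N E r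
... | inj₁ trivial = reach-first-proper-move rest (≈-trans trivial E≈D) F≉D
... | inj₂ R       = r , proper , reach-resp-≈ rest moved
  where
    moved : ghostMove N E r ≈ ghostMove N D r
    moved = ghostMove-cong N E≈D r
    proper : ¬ ghostMove N D r ≈ D
    proper h = newGhost⇒≉ (Relocation.new-ghost R) (≈-trans moved (≈-trans h (≈-sym E≈D)))

relocation-minimal : ∀ {N D₁ r D₂} → Relocation D₁ r D₂ → ∀ T → ¬ (D₂ ≺[ N ] T × T ≺[ N ] D₁)
relocation-minimal R T ((D₂⪯T , D₂≉T) , (T⪯D₁ , T≉D₁))
  with reach-≈-or-newGhost T⪯D₁ | reach-≈-or-newGhost D₂⪯T
... | inj₁ T≈D₁ | _ = T≉D₁ T≈D₁
... | _ | inj₁ D₂≈T = D₂≉T D₂≈T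
... | inj₂ (_ , _ , Tg , ¬D₁g) | inj₂ (_ , _ , D₂g , ¬Tg)
  with Relocation.new-ghost-at-source R (reach-⊆ᴳ D₂⪯T Tg) ¬D₁g
     | Relocation.new-ghost-at-source R D₂g (λ D₁g → ¬Tg (reach-⊆ᴳ T⪯D₁ D₁g))
...   | refl , refl | refl , refl = ¬Tg Tg

covers⇒ghostMove : ∀ {N D₁ D₂} → Covers N D₁ D₂ →
  ∃ λ r → (D₂ ≈ ghostMove N D₁ r) × ¬ (ghostMove N D₁ r ≈ D₁)
covers⇒ghostMove {N} {D₁} ((D₂⪯D₁ , D₂≉D₁) , minimal)
  with reach-first-proper-move D₂⪯D₁ ≈-refl D₂≉D₁
... | r , proper , rest with reach-≈-or-newGhost rest
...   | inj₁ D₂≈ = r , D₂≈ , proper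
...   | inj₂ new = ⊥-elim (minimal (ghostMove N D₁ r)
                     ((rest , newGhost⇒≉ new) , (step r (done ≈-refl) , proper)))

ghostMove⇒covers : ∀ {N D₁ D₂} → (∃ λ r → (D₂ ≈ ghostMove N D₁ r) × ¬ (ghostMove N D₁ r ≈ D₁)) →
  Covers N D₁ D₂
ghostMove⇒covers {N} {D₁} (r , D₂≈ , proper) with ghostMove-view N D₁ r
... | inj₁ trivial = ⊥-elim (proper trivial)
... | inj₂ R = (step r (done D₂≈) , λ D₂≈D₁ → proper (≈-trans (≈-sym D₂≈) D₂≈D₁))
             , relocation-minimal (relocation-resp-≈ D₂≈ R)

corollary3p3 : (N : ℕ) (D : Diagram) → Bounded N D → NoGhost D →
    (D₁ D₂ : Diagram) → InGKD N D D₁ → InGKD N D D₂ →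
    Covers N D₁ D₂ ⇔ (∃ λ r → (D₂ ≈ ghostMove N D₁ r) × ¬ (ghostMove N D₁ r ≈ D₁))
corollary3p3 N D _ _ D₁ D₂ _ _ = mk⇔ covers⇒ghostMove ghostMove⇒covers
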